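{- Let $\underline{\mathbb{Q}}^{+}=\{(x,y)\in\mathbb{N}^{+}\times\mathbb{N}^{+},\ \gcd(x,y)=1\}$, let $|\cdot|:\underline{\mathbb{Q}}^{+}\to\mathbb{R}$ be fundamentally monotone (i.e. $v\lll v'\Rightarrow |v|\le|v'|$), and for $R\in\mathbb{R}$ put $c(|\cdot|\le R)=\{v\in\underline{\mathbb{Q}}^{+}: |v|\le R\}$. If $c(|\cdot|\le R)$ is finite, then it is a corona.
   Context: Setting: $\underline{\mathbb{Q}}^{+}$ carries the Stern–Brocot binary tree structure: each $v=(x,y)$ corresponds to the unique $g_v=\begin{pmatrix}v_-\\ v_+\end{pmatrix}\in \mathrm{SL}_2(\mathbb{N})$ with $v=v_-+v_+$ (vector sum), where $\underline{0}=(1,0)$, $\underline{\infty}=(0,1)$ are allowed as $v_\pm$; the root is $(1,1)$ and the offspring of $v$ are $v+v_+$ and $v+v_-$; $M(v)$ (the mother) is the parent of $v$ in this tree. Edges of the Farey graph are pairs $(v_-,v_+)$ with $\det\begin{pmatrix}v_-\\ v_+\end{pmatrix}=1$. The tree order is $v'\lhd v$ iff $v'=M^n(v)$ for some $n\ge0$. Pointwise order: $(x,y)\prec(x',y')$ iff $x\le x'$ and $y\le y'$. Fundamental order: $v\lll v'$ iff $v_+\prec v'_+$ and $v_-\prec v'_-$ (the paper writes this order with a custom relation symbol). A $\lhd$-set is a finite subset $c\subseteq\underline{\mathbb{Q}}^{+}$ closed under $\lhd$-predecessors; writing its elements in increasing real order $c_1<\dots<c_{m-1}$ with $c_0=\underline{0}$,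 $c_m=\underline{\infty}$, consecutive elements form a path in the Farey graph from $\underline{0}$ to $\underline{\infty}$. $c^{\max}$ is the set of $\lhd$-maximal elements ($c_i=c_{i-1}+c_{i+1}$), $\Phi c=\{v\in c: v+v_+\in c \text{ and } v+v_-\in c\}$ (local $\lhd$-minima), $c^{\min}=\Phi c\cup\{\underline{0},\underline{\infty}\}$. A $\star$-set is a $\lhd$-set such that for every three consecutive points $c_{i+1}>c_i>c_{i-1}$, either $c_i\in c^{\max}$, or $c_i\in c^{\min}$, or $c_i=\tfrac12(c_{i+1}+c_{i-1})$. $\mathcal{C}^\star$ denotes the set of $\star$-sets. The set of coronas is $\bigcap_{n\ge0}\Phi^{ -n}(\mathcal{C}^\star)$, i.e. $c$ such that $\Phi^n c$ is a $\star$-set for every $n\ge0$. -}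

module Defs where

open import Level using (0ℓ)
open import Data.Nat using (ℕ; zero; suc; _+_; _*_; _≤_; _<_)
open import Data.Nat.GCD using (gcd)
open import Data.Product using (Σ; ∃; ∃-syntax; _×_; _,_; proj₁)
open import Data.Sum using (_⊎_)
open import Data.List using (List)
open import Data.List.Membership.Propositional using (_∈_)
open import Relation.Nullary using (¬_)
open import Relation.Binary.PropositionalEquality using (_≡_)
open import Relation.Binary.Construct.Closure.ReflexiveTransitive using (Star)
open import Relation.Binary.Bundles using (TotalOrder)

-- Vectors of ℕ²; (x , y) represents the rational y / x  (0 = (1,0), ∞ = (0,1)).
V : Set
V = ℕ × ℕ

infixl 6 _⊕_
_⊕_ : V → V → V
(x , y) ⊕ (x' , y') = (x + x' , y + y')

𝟘 𝟙∞ : V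
𝟘 = (1 , 0)
𝟙∞ = (0 , 1)

IsQ+ : V → Set
IsQ+ (x , y) = (1 ≤ x) × (1 ≤ y) × (gcd x y ≡ 1)

Q+ : Set
Q+ = Σ V IsQ+

Det1 : V → V → Set
Det1 (x₁ , y₁) (x₂ , y₂) = x₁ * y₂ ≡ 1 + y₁ * x₂

-- Parents v v₋ v₊ : g_v = (v₋ ; v₊) ∈ SL₂(ℕ) with v = v₋ + v₊
Parents : V → V → V → Set
Parents v v₋ v₊ = (v₋ ⊕ v₊ ≡ v) × Det1 v₋ v₊

_≼_ : V → V → Set
(x , y) ≼ (x' , y') = (x ≤ x') × (y ≤ y')

_⋘_ : V → V → Set
v ⋘ v' = ∃[ a ] ∃[ b ] ∃[ a' ] ∃[ b' ]
  (Parents v a b × Parents v' a' b' × (b ≼ b') × (a ≼ a'))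

-- Child v w : w is an offspring of v (w = v + v₊ or w = v + v₋), i.e. M(w) = v
Child : V → V → Set
Child v w = ∃[ a ] ∃[ b ] (Parents v a b × ((w ≡ v ⊕ b) ⊎ (w ≡ v ⊕ a)))

_⊲_ : V → V → Set
v' ⊲ v = Star Child v' v

Set' : Set₁
Set' = V → Set

Finite : Set' → Set
Finite c = ∃[ xs ] (∀ v → c v → v ∈ xs)

-- real order of slopes:  (x,y) < (x',y')  iff  y/x < y'/x'
_<ₛ_ : V → V → Set
(x , y) <ₛ (x' , y') = y * x' < y' * x

⊲Set : Set' → Set
⊲Set c = Finite c × (∀ v → c v → IsQ+ v) × (∀ v w → c w → v ⊲ w → c v)

Ext : Set' → Set'
Ext c v = c v ⊎ (v ≡ 𝟘) ⊎ (v ≡ 𝟙∞)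

LeftNbr : Set' → V → V → Set
LeftNbr c a i = Ext c a × (a <ₛ i) × (∀ w → Ext c w → ¬ ((a <ₛ w) × (w <ₛ i)))

RightNbr : Set' → V → V → Set
RightNbr c i b = Ext c b × (i <ₛ b) × (∀ w → Ext c w → ¬ ((i <ₛ w) × (w <ₛ b)))

Cmax : Set' → Set'
Cmax c v = c v × (∀ w → c w → v ⊲ w → w ≡ v)

Φ : Set' → Set'
Φ c v = c v × ∃[ a ] ∃[ b ] (Parents v a b × c (v ⊕ b) × c (v ⊕ a))

Cmin : Set' → Set'
Cmin c v = Φ c v ⊎ (v ≡ 𝟘) ⊎ (v ≡ 𝟙∞)

StarSet : Set' → Set
StarSet c = ⊲Set c ×
  (∀ a i b → c i → LeftNbr c a i → RightNbr c i b →
     Cmax c i ⊎ Cmin c i ⊎ (i ⊕ i ≡ a ⊕ b))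

Φ^ : ℕ → Set' → Set'
Φ^ zero c = c
Φ^ (suc n) c = Φ (Φ^ n c)

Corona : Set' → Set
Corona c = ∀ n → StarSet (Φ^ n c)

module _ (O : TotalOrder 0ℓ 0ℓ 0ℓ) where
  open TotalOrder O renaming (Carrier to C; _≤_ to _≤ₒ_)

  FundMonotone : (Q+ → C) → Set
  FundMonotone f = ∀ (v v' : Q+) → proj₁ v ⋘ proj₁ v' → f v ≤ₒ f v'

  Sublevel : (Q+ → C) → C → Set'
  Sublevel f R v = Σ (IsQ+ v) λ q → f (v , q) ≤ₒ R

-- The sublevel set c of a fundamentally monotone function is a finite set of ℚ⁺ closed under
-- ⋘-predecessors, and Φ preserves this closure, so it suffices to show that every such set is a
-- ⋆-set. Fix i = p + q in c with left neighbour a. If a lies strictly between p and i, then a is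
-- in the Farey interval of the left child i + p, and every primitive vector strictly inside the
-- Farey interval of a node u dominates u in the fundamental order; hence i + p ∈ c. Otherwise
-- a = p (p is in c or is 0, because p ⋘ i), and i + p ∉ c since it would lie between a and i.
-- The same holds on the right. Both children present makes i a local minimum, both absent a
-- maximum, and in the mixed case, say i + p ∉ c ∋ i + q, the right neighbour is exactly i + q:
-- anything in c strictly between i and i + q would put i + (i + q) in c, which dominates i + p.
-- Then 2i = p + (i + q) = a + b.

module Submission where

open import Defs
open import Level using (0ℓ)
open import Relation.Binary.Bundles using (TotalOrder)
open import Data.Nat using (ℕ; zero; suc; _+_; _*_; _∸_; _≤_; _<_; z≤n; s≤s)
open import Data.Nat.Properties
open import Data.Nat.Divisibility using (_∣_; ∣-refl; ∣-antisym; ∣1⇒≡1; ∣m+n∣m⇒∣n; ∣m∣n⇒∣m+n; ∣m⇒∣m*n; ∣n⇒∣m*n)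
open import Data.Nat.Coprimality as Coprimality using (Coprime; coprime⇒gcd≡1; gcd≡1⇒coprime; coprime-divisor)
open import Data.Nat.Tactic.RingSolver using (solve; solve-∀)
open import Data.List using ([]; _∷_)
open import Data.Product using (∃; ∃₂; ∃-syntax; _×_; _,_; proj₁; proj₂; swap)
open import Data.Sum using (_⊎_; inj₁; inj₂)
open import Data.Empty using (⊥-elim)
open import Relation.Nullary using (¬_)
open import Relation.Binary.Definitions using (Tri; tri<; tri≈; tri>)
open import Relation.Binary.PropositionalEquality
open import Relation.Binary.Construct.Closure.ReflexiveTransitive using (ε; _◅_)
open ≡-Reasoning

⊕-comm : ∀ u w → u ⊕ w ≡ w ⊕ u
⊕-comm (ux , uy) (wx , wy) = cong₂ _,_ (+-comm ux wx) (+-comm uy wy)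

⊕-cancelʳ : ∀ u u' w → u ⊕ w ≡ u' ⊕ w → u ≡ u'
⊕-cancelʳ (ux , uy) (ux' , uy') (wx , wy) e =
  cong₂ _,_ (+-cancelʳ-≡ wx ux ux' (cong proj₁ e)) (+-cancelʳ-≡ wy uy uy' (cong proj₂ e))

≼-refl : ∀ {v} → v ≼ v
≼-refl = ≤-refl , ≤-refl

≼-antisym : ∀ {u w} → u ≼ w → w ≼ u → u ≡ w
≼-antisym (x≤ , y≤) (x≥ , y≥) = cong₂ _,_ (≤-antisym x≤ x≥) (≤-antisym y≤ y≥)

u≼u⊕w : ∀ u w → u ≼ (u ⊕ w)
u≼u⊕w (ux , uy) (wx , wy) = m≤m+n ux wx , m≤m+n uy wy

w≼u⊕w : ∀ u w → w ≼ (u ⊕ w)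
w≼u⊕w (ux , uy) (wx , wy) = m≤n+m wx ux , m≤n+m wy uy

⊕-mono-≼ : ∀ {u u' w w'} → u ≼ u' → w ≼ w' → (u ⊕ w) ≼ (u' ⊕ w')
⊕-mono-≼ (x≤ , y≤) (x≤' , y≤') = +-mono-≤ x≤ x≤' , +-mono-≤ y≤ y≤'

lin : V → V → V → V
lin (px , py) (qx , qy) (a , b) = (a * px + b * qx , a * py + b * qy)

lin-⊕ : ∀ p q u w → lin p q (u ⊕ w) ≡ lin p q u ⊕ lin p q w
lin-⊕ (px , py) (qx , qy) (a , b) (c , d) = cong₂ _,_ (distrib a b c d px qx) (distrib a b c d py qy)
  where
  distrib : ∀ a b c d x y → (a + c) * x + (b + d) * y ≡ (a * x + b * y) + (c * x + d * y)
  distrib = solve-∀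

≼-linˡ : ∀ p q {a} b → 1 ≤ a → p ≼ lin p q (a , b)
≼-linˡ (px , py) (qx , qy) {suc a} b _ = x≤ px qx , x≤ py qy
  where
  x≤ : ∀ x y → x ≤ suc a * x + b * y
  x≤ x y = ≤-trans (m≤m+n x (a * x)) (m≤m+n (suc a * x) (b * y))

≼-linʳ : ∀ p q a {b} → 1 ≤ b → q ≼ lin p q (a , b)
≼-linʳ (px , py) (qx , qy) a {suc b} _ = y≤ px qx , y≤ py qy
  where
  y≤ : ∀ x y → y ≤ a * x + suc b * y
  y≤ x y = ≤-trans (m≤m+n y (b * y)) (m≤n+m (suc b * y) (a * x))

Primitive : V → Set
Primitive (x , y) = Coprime x y

-- Det1 p q is definitionally Det p q 1.
Det : V → V → ℕ → Set
Det (px , py) (qx , qy) k = px * qy ≡ k + py * qx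

_≤ₛ_ _=ₛ_ : V → V → Set
(x , y) ≤ₛ (x' , y') = y * x' ≤ y' * x
(x , y) =ₛ (x' , y') = y * x' ≡ y' * x

<ₛ-cmp : ∀ u w → Tri (u <ₛ w) (u =ₛ w) (w <ₛ u)
<ₛ-cmp (ux , uy) (wx , wy) = <-cmp (uy * wx) (wy * ux)

∞≮ₛ : ∀ w → ¬ 𝟙∞ <ₛ w
∞≮ₛ (wx , wy) ∞<w = n≮0 (subst (1 * wx <_) (*-zeroʳ wy) ∞<w)

=ₛ⇒≡ : ∀ {u w} → Primitive u → Primitive w → u =ₛ w → u ≡ w
=ₛ⇒≡ {ux , uy} {wx , wy} cop-u cop-w e = cong₂ _,_
  (∣-antisym (coprime-divisor cop-u (subst (ux ∣_) (sym e) (∣n⇒∣m*n wy ∣-refl)))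
             (coprime-divisor cop-w (subst (wx ∣_) e (∣n⇒∣m*n uy ∣-refl))))
  (∣-antisym (coprime-divisor (Coprimality.sym cop-u) (subst (uy ∣_) (trans e (*-comm wy ux)) (∣m⇒∣m*n wx ∣-refl)))
             (coprime-divisor (Coprimality.sym cop-w) (subst (wy ∣_) (trans (sym e) (*-comm uy wx)) (∣m⇒∣m*n ux ∣-refl))))

≤ₛ⇒Det : ∀ p q → p ≤ₛ q → ∃ (Det p q)
≤ₛ⇒Det (px , py) (qx , qy) le = qy * px ∸ py * qx , trans (*-comm px qy) (sym (m∸n+n≡m le))

<ₛ⇒Det : ∀ p q → p <ₛ q → ∃[ k ] Det p q (suc k)
<ₛ⇒Det (px , py) (qx , qy) lt = qy * px ∸ suc (py * qx) , (begin
  px * qy                                    ≡⟨ *-comm px qy ⟩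
  qy * px                                    ≡⟨ m∸n+n≡m lt ⟨
  (qy * px ∸ suc (py * qx)) + suc (py * qx)  ≡⟨ +-suc _ (py * qx) ⟩
  suc (qy * px ∸ suc (py * qx)) + py * qx    ∎)

Det⇒<ₛ : ∀ p q {k} → Det p q (suc k) → p <ₛ q
Det⇒<ₛ (px , py) (qx , qy) {k} d =
  ≤-trans (s≤s (m≤n+m (py * qx) k)) (≤-reflexive (trans (sym d) (*-comm px qy)))

Det-suc⇒1≤ˣ : ∀ p q {k} → Det p q (suc k) → 1 ≤ proj₁ p
Det-suc⇒1≤ˣ (suc _ , _) _ _ = s≤s z≤n

Det-suc⇒1≤ʸ : ∀ p q {k} → Det p q (suc k) → 1 ≤ proj₂ q
Det-suc⇒1≤ʸ (px , _) (_ , zero) d = ⊥-elim (1+n≢0 (trans (sym d) (*-zeroʳ px)))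
Det-suc⇒1≤ʸ _ (_ , suc _) _ = s≤s z≤n

∣1+n∣n⇒≡1 : ∀ {d} n → d ∣ 1 + n → d ∣ n → d ≡ 1
∣1+n∣n⇒≡1 {d} n d∣1+n d∣n = ∣1⇒≡1 (∣m+n∣m⇒∣n (subst (d ∣_) (+-comm 1 n) d∣1+n) d∣n)

Det1⇒Primitiveˡ : ∀ p q → Det p q 1 → Primitive p
Det1⇒Primitiveˡ (px , py) (qx , qy) dpq {d} (d∣px , d∣py) =
  ∣1+n∣n⇒≡1 (py * qx) (subst (d ∣_) dpq (∣m⇒∣m*n qy d∣px)) (∣m⇒∣m*n qx d∣py)

Det1⇒Primitiveʳ : ∀ p q → Det p q 1 → Primitive q
Det1⇒Primitiveʳ (px , py) (qx , qy) dpq {d} (d∣qx , d∣qy) =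
  ∣1+n∣n⇒≡1 (py * qx) (subst (d ∣_) dpq (∣n⇒∣m*n px d∣qy)) (∣n⇒∣m*n py d∣qx)

Det1⇒Q+ˡ : ∀ p q → Det p q 1 → 1 ≤ proj₂ p → IsQ+ p
Det1⇒Q+ˡ p q d 1≤py = Det-suc⇒1≤ˣ p q d , 1≤py , coprime⇒gcd≡1 (Det1⇒Primitiveˡ p q d)

Det1⇒Q+ʳ : ∀ p q → Det p q 1 → 1 ≤ proj₁ q → IsQ+ q
Det1⇒Q+ʳ p q d 1≤qx = 1≤qx , Det-suc⇒1≤ʸ p q d , coprime⇒gcd≡1 (Det1⇒Primitiveʳ p q d)

Det-swap : ∀ p q {k} → Det p q k → Det (swap q) (swap p) k
Det-swap (px , py) (qx , qy) {k} d = trans (*-comm qy px) (trans d (cong (k +_) (*-comm py qx)))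

Det-⊕ʳ : ∀ p q {k} → Det p q k → Det p (p ⊕ q) k
Det-⊕ʳ (px , py) (qx , qy) {k} d = begin
  px * (py + qy)           ≡⟨ *-distribˡ-+ px py qy ⟩
  px * py + px * qy        ≡⟨ cong (px * py +_) d ⟩
  px * py + (k + py * qx)  ≡⟨ solve (px ∷ py ∷ qx ∷ k ∷ []) ⟩
  k + py * (px + qx)       ∎

Det-⊕ˡ : ∀ p q {k} → Det p q k → Det (p ⊕ q) q k
Det-⊕ˡ (px , py) (qx , qy) {k} d = begin
  (px + qx) * qy           ≡⟨ *-distribʳ-+ qy px qx ⟩
  px * qy + qx * qy        ≡⟨ cong (_+ qx * qy) d ⟩
  (k + py * qx) + qx * qy  ≡⟨ solve (py ∷ qx ∷ qy ∷ k ∷ []) ⟩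
  k + (py + qy) * qx       ∎

Det-lin : ∀ p q a b {m n} → Det p q m → Det a b n → Det (lin p q a) (lin p q b) (n * m)
Det-lin (px , py) (qx , qy) (a₁ , b₁) (a₂ , b₂) {m} {n} dpq dab = begin
  (a₁ * px + b₁ * qx) * (a₂ * py + b₂ * qy)
    ≡⟨ solve (a₁ ∷ b₁ ∷ a₂ ∷ b₂ ∷ px ∷ py ∷ qx ∷ qy ∷ []) ⟩
  a₁ * a₂ * (px * py) + (a₁ * b₂) * (px * qy) + b₁ * a₂ * (qx * py) + b₁ * b₂ * (qx * qy)
    ≡⟨ cong₂ (λ s t → a₁ * a₂ * (px * py) + s * t + b₁ * a₂ * (qx * py) + b₁ * b₂ * (qx * qy)) dab dpq ⟩
  a₁ * a₂ * (px * py) + (n + b₁ * a₂) * (m + py * qx) + b₁ * a₂ * (qx * py) + b₁ * b₂ * (qx * qy)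
    ≡⟨ solve (a₁ ∷ b₁ ∷ a₂ ∷ b₂ ∷ px ∷ py ∷ qx ∷ qy ∷ m ∷ n ∷ []) ⟩
  n * m + a₁ * a₂ * (py * px) + (n + b₁ * a₂) * (py * qx) + b₁ * a₂ * (m + py * qx) + b₁ * b₂ * (qy * qx)
    ≡⟨ cong₂ (λ s t → n * m + a₁ * a₂ * (py * px) + s * (py * qx) + b₁ * a₂ * t + b₁ * b₂ * (qy * qx)) dab dpq ⟨
  n * m + a₁ * a₂ * (py * px) + (a₁ * b₂) * (py * qx) + b₁ * a₂ * (px * qy) + b₁ * b₂ * (qy * qx)
    ≡⟨ solve (a₁ ∷ b₁ ∷ a₂ ∷ b₂ ∷ px ∷ py ∷ qx ∷ qy ∷ m ∷ n ∷ []) ⟩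
  n * m + (a₁ * py + b₁ * qy) * (a₂ * px + b₂ * qx)
    ∎

-- Cramer's rule for the unimodular basis (p , q): w = det(w ; q) p + det(p ; w) q.
cramer : ∀ p q w {α β} → Det p q 1 → Det w q α → Det p w β → lin p q (α , β) ≡ w
cramer (px , py) (qx , qy) (wx , wy) {α} {β} dpq dwq dpw = cong₂ _,_
  (+-cancelʳ-≡ (wy * qx * px + py * wx * qx) _ _ (begin
    α * px + β * qx + (wy * qx * px + py * wx * qx)  ≡⟨ solve (px ∷ py ∷ qx ∷ wx ∷ wy ∷ α ∷ β ∷ []) ⟩
    (α + wy * qx) * px + (β + py * wx) * qx          ≡⟨ cong₂ (λ s t → s * px + t * qx) dwq dpw ⟨
    wx * qy * px + px * wy * qx                      ≡⟨ solve (px ∷ qx ∷ qy ∷ wx ∷ wy ∷ []) ⟩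
    wx * (px * qy) + wy * px * qx                    ≡⟨ cong (λ s → wx * s + wy * px * qx) dpq ⟩
    wx * (1 + py * qx) + wy * px * qx                ≡⟨ solve (px ∷ py ∷ qx ∷ wx ∷ wy ∷ []) ⟩
    wx + (wy * qx * px + py * wx * qx)               ∎))
  (+-cancelʳ-≡ (wy * qx * py + py * wx * qy) _ _ (begin
    α * py + β * qy + (wy * qx * py + py * wx * qy)  ≡⟨ solve (py ∷ qx ∷ qy ∷ wx ∷ wy ∷ α ∷ β ∷ []) ⟩
    (α + wy * qx) * py + (β + py * wx) * qy          ≡⟨ cong₂ (λ s t → s * py + t * qy) dwq dpw ⟨
    wx * qy * py + px * wy * qy                      ≡⟨ solve (px ∷ py ∷ qy ∷ wx ∷ wy ∷ []) ⟩
    wy * (px * qy) + wx * qy * py                    ≡⟨ cong (λ s → wy * s + wx * qy * py) dpq ⟩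
    wy * (1 + py * qx) + wx * qy * py                ≡⟨ solve (py ∷ qx ∷ qy ∷ wx ∷ wy ∷ []) ⟩
    wy + (wy * qx * py + py * wx * qy)               ∎))

lin-coprime : ∀ p q a b → Primitive (lin p q (a , b)) → Coprime a b
lin-coprime (px , py) (qx , qy) a b cop (d∣a , d∣b) =
  cop (∣m∣n⇒∣m+n (∣m⇒∣m*n px d∣a) (∣m⇒∣m*n qx d∣b) , ∣m∣n⇒∣m+n (∣m⇒∣m*n py d∣a) (∣m⇒∣m*n qy d∣b))

-- The vectors r with det (p ; r) = 1 differ by multiples of p, so one lying below p lies below all.
Det1-partnerʳ-≼ : ∀ p q r → Det p q 1 → Det p r 1 → r ≼ p → r ≼ q
Det1-partnerʳ-≼ p@(px , py) q@(qx , qy) r@(rx , ry) dpq dpr r≼p with ≤-total (ry * qx) (qy * rx)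
... | inj₁ r≤ₛq with ≤ₛ⇒Det r q r≤ₛq
...   | zero , drq = subst (_≼ q) (cramer p q r dpq drq dpr)
                       (≤-reflexive (+-identityʳ qx) , ≤-reflexive (+-identityʳ qy))
...   | suc α , drq = ⊥-elim (m+1+n≰m py (≤-trans py+1≤ry (proj₂ r≼p)))
  where
  py+1≤ry : py + 1 ≤ ry
  py+1≤ry = ≤-trans (+-mono-≤ (m≤m+n py (α * py)) (≤-trans (Det-suc⇒1≤ʸ p q dpq) (m≤m+n qy 0)))
                    (≤-reflexive (cong proj₂ (cramer p q r dpq drq dpr)))
Det1-partnerʳ-≼ p q r dpq dpr r≼p | inj₂ q≤ₛr with ≤ₛ⇒Det q r q≤ₛr
... | α , dqr = subst (r ≼_) (cramer p r q dpr dqr dpq) (≼-linʳ p r α {1} (s≤s z≤n))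

Det1-partnerˡ-≼ : ∀ p q r → Det q p 1 → Det r p 1 → r ≼ p → r ≼ q
Det1-partnerˡ-≼ p q r dqp drp r≼p =
  swap (Det1-partnerʳ-≼ (swap p) (swap q) (swap r) (Det-swap q p dqp) (Det-swap r p drp) (swap r≼p))

Parents-childˡ : ∀ v a b → Parents v a b → Parents (v ⊕ a) a v
Parents-childˡ _ a b (refl , d) = ⊕-comm a (a ⊕ b) , Det-⊕ʳ a b d

Parents-childʳ : ∀ v a b → Parents v a b → Parents (v ⊕ b) v b
Parents-childʳ _ a b (refl , d) = refl , Det-⊕ˡ a b d

Parents⇒≼ : ∀ v a b → Parents v a b → a ≼ v × b ≼ v
Parents⇒≼ _ a b (refl , _) = u≼u⊕w a b , w≼u⊕w a b

Parents⇒<ₛ : ∀ v a b → Parents v a b → a <ₛ v × v <ₛ b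
Parents⇒<ₛ _ a b (refl , d) = Det⇒<ₛ a (a ⊕ b) (Det-⊕ʳ a b d) , Det⇒<ₛ (a ⊕ b) b (Det-⊕ˡ a b d)

Parents⇒Q+ : ∀ v a b → Parents v a b → IsQ+ v
Parents⇒Q+ _ a b (refl , d) = Det1⇒Q+ʳ a (a ⊕ b) (Det-⊕ʳ a b d) (Det-suc⇒1≤ˣ (a ⊕ b) b (Det-⊕ˡ a b d))

Parents⇒Primitive : ∀ v a b → Parents v a b → Primitive v
Parents⇒Primitive v a b P = gcd≡1⇒coprime (proj₂ (proj₂ (Parents⇒Q+ v a b P)))

Parents-lin : ∀ p q v a b → Det p q 1 → Parents v a b → Parents (lin p q v) (lin p q a) (lin p q b)
Parents-lin p q _ a b dpq (refl , dab) = sym (lin-⊕ p q a b) , Det-lin p q a b dpq dab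

Parents-unique : ∀ v a b a' b' → Parents v a b → Parents v a' b' → a ≡ a' × b ≡ b'
Parents-unique v a b a' b' P P' = ⊕-cancelʳ a a' b a⊕b≡a'⊕b , b≡b'
  where
  dvb  = proj₂ (Parents-childʳ v a b P)
  dvb' = proj₂ (Parents-childʳ v a' b' P')
  b≡b' : b ≡ b'
  b≡b' = ≼-antisym (Det1-partnerʳ-≼ v b' b dvb' dvb (proj₂ (Parents⇒≼ v a b P)))
                   (Det1-partnerʳ-≼ v b b' dvb dvb' (proj₂ (Parents⇒≼ v a' b' P')))
  a⊕b≡a'⊕b : a ⊕ b ≡ a' ⊕ b
  a⊕b≡a'⊕b = trans (proj₁ P) (trans (sym (proj₁ P')) (cong (a' ⊕_) (sym b≡b')))

Parents⇒i⊕i≡p⊕[i⊕q] : ∀ i p q → Parents i p q → i ⊕ i ≡ p ⊕ (i ⊕ q)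
Parents⇒i⊕i≡p⊕[i⊕q] _ (px , py) (qx , qy) (refl , _) = cong₂ _,_ (regroup px qx) (regroup py qy)
  where
  regroup : ∀ p q → (p + q) + (p + q) ≡ p + ((p + q) + q)
  regroup = solve-∀

Parents⇒i⊕i≡[i⊕p]⊕q : ∀ i p q → Parents i p q → i ⊕ i ≡ (i ⊕ p) ⊕ q
Parents⇒i⊕i≡[i⊕p]⊕q _ (px , py) (qx , qy) (refl , _) = cong₂ _,_ (regroup px qx) (regroup py qy)
  where
  regroup : ∀ p q → (p + q) + (p + q) ≡ ((p + q) + p) + q
  regroup = solve-∀

-- Euclid's algorithm, run backwards through the shears (x , y) ↦ (x , x + y) and (x , y) ↦ (x + y , y).
coprime-parents : ∀ n {x y} → x + y ≤ n → 1 ≤ x → 1 ≤ y → Coprime x y → ∃₂ (Parents (x , y))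
coprime-parents zero {suc _} () _ _ _
coprime-parents (suc n) {x} {y} bound 1≤x 1≤y cop with <-cmp x y
... | tri≈ _ refl _ with cop (∣-refl , ∣-refl)
...   | refl = (1 , 0) , (0 , 1) , refl , refl
coprime-parents (suc n) {x} {y} bound 1≤x 1≤y cop | tri< x<y _ _ =
  subst (λ v → ∃₂ (Parents v)) (cong₂ _,_ (shear-x x γ) (trans (shear-y x γ) x+γ≡y))
        (lift (coprime-parents n bound′ 1≤x (m<n⇒0<n∸m x<y) cop′))
  where
  γ = y ∸ x
  x+γ≡y : x + γ ≡ y
  x+γ≡y = m+[n∸m]≡n (<⇒≤ x<y)
  bound′ : x + γ ≤ n
  bound′ = subst (_≤ n) (sym x+γ≡y) (≤-pred (≤-trans (m<n+m y 1≤x) bound))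
  cop′ : Coprime x γ
  cop′ {d} (d∣x , d∣γ) = cop (d∣x , subst (d ∣_) x+γ≡y (∣m∣n⇒∣m+n d∣x d∣γ))
  lift : ∃₂ (Parents (x , γ)) → ∃₂ (Parents (lin (1 , 1) (0 , 1) (x , γ)))
  lift (a , b , P) = lin (1 , 1) (0 , 1) a , lin (1 , 1) (0 , 1) b , Parents-lin (1 , 1) (0 , 1) (x , γ) a b refl P
  shear-x : ∀ x γ → x * 1 + γ * 0 ≡ x
  shear-x = solve-∀
  shear-y : ∀ x γ → x * 1 + γ * 1 ≡ x + γ
  shear-y = solve-∀
coprime-parents (suc n) {x} {y} bound 1≤x 1≤y cop | tri> _ _ y<x =
  subst (λ v → ∃₂ (Parents v)) (cong₂ _,_ (trans (shear-x γ y) γ+y≡x) (shear-y γ y))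
        (lift (coprime-parents n bound′ (m<n⇒0<n∸m y<x) 1≤y cop′))
  where
  γ = x ∸ y
  γ+y≡x : γ + y ≡ x
  γ+y≡x = m∸n+n≡m (<⇒≤ y<x)
  bound′ : γ + y ≤ n
  bound′ = subst (_≤ n) (sym γ+y≡x) (≤-pred (≤-trans (m<m+n x 1≤y) bound))
  cop′ : Coprime γ y
  cop′ {d} (d∣γ , d∣y) = cop (subst (d ∣_) γ+y≡x (∣m∣n⇒∣m+n d∣γ d∣y) , d∣y)
  lift : ∃₂ (Parents (γ , y)) → ∃₂ (Parents (lin (1 , 0) (1 , 1) (γ , y)))
  lift (a , b , P) = lin (1 , 0) (1 , 1) a , lin (1 , 0) (1 , 1) b , Parents-lin (1 , 0) (1 , 1) (γ , y) a b refl P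
  shear-x : ∀ γ y → γ * 1 + y * 1 ≡ γ + y
  shear-x = solve-∀
  shear-y : ∀ γ y → γ * 0 + y * 1 ≡ y
  shear-y = solve-∀

parents-exist : ∀ {v} → IsQ+ v → ∃₂ (Parents v)
parents-exist {x , y} (1≤x , 1≤y , gcd≡1) = coprime-parents (x + y) ≤-refl 1≤x 1≤y (gcd≡1⇒coprime gcd≡1)

leftParent-⋘ : ∀ i p q l r → Parents i p q → Parents p l r → p ⋘ i
leftParent-⋘ i p q l r Pi Pp = l , r , p , q , Pp , Pi ,
  Det1-partnerʳ-≼ p q r (proj₂ Pi) (proj₂ (Parents-childʳ p l r Pp)) (proj₂ (Parents⇒≼ p l r Pp)) ,
  proj₁ (Parents⇒≼ p l r Pp)

rightParent-⋘ : ∀ i p q l r → Parents i p q → Parents q l r → q ⋘ i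
rightParent-⋘ i p q l r Pi Pq = l , r , p , q , Pq , Pi ,
  proj₂ (Parents⇒≼ q l r Pq) ,
  Det1-partnerˡ-≼ q p l (proj₂ Pi) (proj₂ (Parents-childˡ q l r Pq)) (proj₁ (Parents⇒≼ q l r Pq))

-- Write w = α p + β q (Cramer) with α, β ≥ 1 coprime; the matrix with rows p and q lies in
-- SL₂(ℕ), so it maps the parents of (α , β) to parents of w, which dominate p and q.
⋘-between : ∀ u p q w → Parents u p q → Primitive w → p <ₛ w → w <ₛ q → u ⋘ w
⋘-between u p q w Pu cop-w p<w w<q =
  let α , dwq = <ₛ⇒Det w q w<q
      β , dpw = <ₛ⇒Det p w p<w
      w≡ = cramer p q w (proj₂ Pu) dwq dpw
      cop-αβ = lin-coprime p q (suc α) (suc β) (subst Primitive (sym w≡) cop-w)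
      A , B , PA = parents-exist {suc α , suc β} (s≤s z≤n , s≤s z≤n , coprime⇒gcd≡1 cop-αβ)
      Pw = subst (λ v → Parents v (lin p q A) (lin p q B)) w≡ (Parents-lin p q _ A B (proj₂ Pu) PA)
  in p , q , lin p q A , lin p q B , Pu , Pw ,
     ≼-linʳ p q (proj₁ B) (Det-suc⇒1≤ʸ A B (proj₂ PA)) ,
     ≼-linˡ p q (proj₂ A) (Det-suc⇒1≤ˣ A B (proj₂ PA))

Child⇒⋘ : ∀ v w → Child v w → v ⋘ w
Child⇒⋘ v _ (a , b , P , inj₁ refl) = a , b , v , b , P , Parents-childʳ v a b P , ≼-refl , proj₁ (Parents⇒≼ v a b P)
Child⇒⋘ v _ (a , b , P , inj₂ refl) = a , b , a , v , P , Parents-childˡ v a b P , proj₂ (Parents⇒≼ v a b P) , ≼-refl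

record FundLowerSet (c : Set') : Set where
  field
    finite   : Finite c
    ⊆Q+      : ∀ {v} → c v → IsQ+ v
    ⋘-closed : ∀ {v w} → c w → v ⋘ w → c v

module FundLowerSetProperties {c : Set'} (L : FundLowerSet c) where
  open FundLowerSet L

  ⊲-closed : ∀ {v w} → v ⊲ w → c w → c v
  ⊲-closed ε cw = cw
  ⊲-closed (ch ◅ s) cw = ⋘-closed (⊲-closed s cw) (Child⇒⋘ _ _ ch)

  Ext⇒Primitive : ∀ {w} → Ext c w → Primitive w
  Ext⇒Primitive (inj₁ cw) = gcd≡1⇒coprime (proj₂ (proj₂ (⊆Q+ cw)))
  Ext⇒Primitive (inj₂ (inj₁ refl)) (d∣1 , _) = ∣1⇒≡1 d∣1
  Ext⇒Primitive (inj₂ (inj₂ refl)) (_ , d∣1) = ∣1⇒≡1 d∣1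

  Ext-between : ∀ p q {w} → Ext c w → p <ₛ w → w <ₛ q → c w
  Ext-between p q (inj₁ cw) _ _ = cw
  Ext-between p q (inj₂ (inj₁ refl)) () _
  Ext-between p q (inj₂ (inj₂ refl)) _ ∞<q = ⊥-elim (∞≮ₛ q ∞<q)

  leftParent∈Ext : ∀ i p q → c i → Parents i p q → Ext c p
  leftParent∈Ext i (px , zero) (qx , qy) ci (_ , d) = inj₂ (inj₁ (cong (_, 0) (m*n≡1⇒m≡1 px qy d)))
  leftParent∈Ext i p@(_ , suc _) q ci Pi =
    let l , r , Pp = parents-exist (Det1⇒Q+ˡ p q (proj₂ Pi) (s≤s z≤n))
    in inj₁ (⋘-closed ci (leftParent-⋘ i p q l r Pi Pp))

  rightParent∈Ext : ∀ i p q → c i → Parents i p q → Ext c q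
  rightParent∈Ext i (px , py) (zero , qy) ci (_ , d) =
    inj₂ (inj₂ (cong (0 ,_) (m*n≡1⇒n≡1 px qy (trans d (cong suc (*-zeroʳ py))))))
  rightParent∈Ext i p q@(suc _ , _) ci Pi =
    let l , r , Pq = parents-exist (Det1⇒Q+ʳ p q (proj₂ Pi) (s≤s z≤n))
    in inj₁ (⋘-closed ci (rightParent-⋘ i p q l r Pi Pq))

  leftChild-or-leftParent : ∀ {a} i p q → c i → Parents i p q → LeftNbr c a i →
                            c (i ⊕ p) ⊎ (a ≡ p × ¬ c (i ⊕ p))
  leftChild-or-leftParent {a} i p q ci Pi (Ea , a<i , gap) with <ₛ-cmp p a
  ... | tri< p<a _ _ =
    inj₁ (⋘-closed (Ext-between p i Ea p<a a<i)
                   (⋘-between (i ⊕ p) p i a (Parents-childˡ i p q Pi) (Ext⇒Primitive Ea) p<a a<i))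
  ... | tri≈ _ p=a _ =
    let a≡p = sym (=ₛ⇒≡ (Det1⇒Primitiveˡ p q (proj₂ Pi)) (Ext⇒Primitive Ea) p=a)
        p<i⊕p , i⊕p<i = Parents⇒<ₛ (i ⊕ p) p i (Parents-childˡ i p q Pi)
    in inj₂ (a≡p , λ c[i⊕p] → gap (i ⊕ p) (inj₁ c[i⊕p]) (subst (_<ₛ (i ⊕ p)) (sym a≡p) p<i⊕p , i⊕p<i))
  ... | tri> _ _ a<p = ⊥-elim (gap p (leftParent∈Ext i p q ci Pi) (a<p , proj₁ (Parents⇒<ₛ i p q Pi)))

  rightChild-or-rightParent : ∀ {b} i p q → c i → Parents i p q → RightNbr c i b →
                              c (i ⊕ q) ⊎ (b ≡ q × ¬ c (i ⊕ q))
  rightChild-or-rightParent {b} i p q ci Pi (Eb , i<b , gap) with <ₛ-cmp b q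
  ... | tri< b<q _ _ =
    inj₁ (⋘-closed (Ext-between i q Eb i<b b<q)
                   (⋘-between (i ⊕ q) i q b (Parents-childʳ i p q Pi) (Ext⇒Primitive Eb) i<b b<q))
  ... | tri≈ _ b=q _ =
    let b≡q = =ₛ⇒≡ (Ext⇒Primitive Eb) (Det1⇒Primitiveʳ p q (proj₂ Pi)) b=q
        i<i⊕q , i⊕q<q = Parents⇒<ₛ (i ⊕ q) i q (Parents-childʳ i p q Pi)
    in inj₂ (b≡q , λ c[i⊕q] → gap (i ⊕ q) (inj₁ c[i⊕q]) (i<i⊕q , subst ((i ⊕ q) <ₛ_) (sym b≡q) i⊕q<q))
  ... | tri> _ _ q<b = ⊥-elim (gap q (rightParent∈Ext i p q ci Pi) (proj₂ (Parents⇒<ₛ i p q Pi) , q<b))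

  rightNbr≡rightChild : ∀ {b} i p q → c i → Parents i p q → ¬ c (i ⊕ p) → c (i ⊕ q) →
                        RightNbr c i b → b ≡ i ⊕ q
  rightNbr≡rightChild {b} i p q ci Pi ¬cL cR (Eb , i<b , gap) with <ₛ-cmp b (i ⊕ q)
  ... | tri< b<R _ _ = ⊥-elim (¬cL (⋘-closed cU (p , i , i , i ⊕ q , PL , PU , u≼u⊕w i q , proj₁ (Parents⇒≼ i p q Pi))))
    where
    PR = Parents-childʳ i p q Pi
    PL = Parents-childˡ i p q Pi
    PU = Parents-childˡ (i ⊕ q) i q PR
    cU = ⋘-closed (Ext-between i (i ⊕ q) Eb i<b b<R) (⋘-between _ i (i ⊕ q) b PU (Ext⇒Primitive Eb) i<b b<R)
  ... | tri≈ _ b=R _ = =ₛ⇒≡ (Ext⇒Primitive Eb) (Parents⇒Primitive (i ⊕ q) i q (Parents-childʳ i p q Pi)) b=R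
  ... | tri> _ _ R<b = ⊥-elim (gap (i ⊕ q) (inj₁ cR) (proj₁ (Parents⇒<ₛ (i ⊕ q) i q (Parents-childʳ i p q Pi)) , R<b))

  leftNbr≡leftChild : ∀ {a} i p q → c i → Parents i p q → ¬ c (i ⊕ q) → c (i ⊕ p) →
                      LeftNbr c a i → a ≡ i ⊕ p
  leftNbr≡leftChild {a} i p q ci Pi ¬cR cL (Ea , a<i , gap) with <ₛ-cmp (i ⊕ p) a
  ... | tri< L<a _ _ = ⊥-elim (¬cR (⋘-closed cU (i , q , i ⊕ p , i , PR , PU , proj₂ (Parents⇒≼ i p q Pi) , u≼u⊕w i p)))
    where
    PR = Parents-childʳ i p q Pi
    PL = Parents-childˡ i p q Pi
    PU = Parents-childʳ (i ⊕ p) p i PL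
    cU = ⋘-closed (Ext-between (i ⊕ p) i Ea L<a a<i) (⋘-between _ (i ⊕ p) i a PU (Ext⇒Primitive Ea) L<a a<i)
  ... | tri≈ _ L=a _ = sym (=ₛ⇒≡ (Parents⇒Primitive (i ⊕ p) p i (Parents-childˡ i p q Pi)) (Ext⇒Primitive Ea) L=a)
  ... | tri> _ _ a<L = ⊥-elim (gap (i ⊕ p) (inj₁ cL) (a<L , proj₂ (Parents⇒<ₛ (i ⊕ p) p i (Parents-childˡ i p q Pi))))

  childless⇒Cmax : ∀ i p q → c i → Parents i p q → ¬ c (i ⊕ p) → ¬ c (i ⊕ q) → Cmax c i
  childless⇒Cmax i p q ci Pi ¬cL ¬cR = ci , maximal
    where
    maximal : ∀ w → c w → i ⊲ w → w ≡ i
    maximal w cw ε = refl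
    maximal w cw ((a , b , P , inj₁ refl) ◅ s) =
      ⊥-elim (¬cR (subst (λ t → c (i ⊕ t)) (sym (proj₂ (Parents-unique i p q a b Pi P))) (⊲-closed s cw)))
    maximal w cw ((a , b , P , inj₂ refl) ◅ s) =
      ⊥-elim (¬cL (subst (λ t → c (i ⊕ t)) (sym (proj₁ (Parents-unique i p q a b Pi P))) (⊲-closed s cw)))

  isStarSet : StarSet c
  isStarSet = (finite , (λ _ → ⊆Q+) , (λ _ _ cw v⊲w → ⊲-closed v⊲w cw)) , classify
    where
    classify : ∀ a i b → c i → LeftNbr c a i → RightNbr c i b → Cmax c i ⊎ Cmin c i ⊎ (i ⊕ i ≡ a ⊕ b)
    classify a i b ci La Rb with parents-exist (⊆Q+ ci)
    ... | p , q , Pi with leftChild-or-leftParent i p q ci Pi La | rightChild-or-rightParent i p q ci Pi Rb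
    ... | inj₁ cL | inj₁ cR = inj₂ (inj₁ (inj₁ (ci , p , q , Pi , cR , cL)))
    ... | inj₂ (_ , ¬cL) | inj₂ (_ , ¬cR) = inj₁ (childless⇒Cmax i p q ci Pi ¬cL ¬cR)
    ... | inj₂ (a≡p , ¬cL) | inj₁ cR = inj₂ (inj₂ (trans (Parents⇒i⊕i≡p⊕[i⊕q] i p q Pi)
            (cong₂ _⊕_ (sym a≡p) (sym (rightNbr≡rightChild i p q ci Pi ¬cL cR Rb)))))
    ... | inj₁ cL | inj₂ (b≡q , ¬cR) = inj₂ (inj₂ (trans (Parents⇒i⊕i≡[i⊕p]⊕q i p q Pi)
            (cong₂ _⊕_ (sym (leftNbr≡leftChild i p q ci Pi ¬cR cL La)) (sym b≡q))))

open FundLowerSetProperties using (isStarSet)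

Φ-fundLowerSet : ∀ {c} → FundLowerSet c → FundLowerSet (Φ c)
Φ-fundLowerSet {c} L = record
  { finite   = proj₁ finite , λ v Φcv → proj₂ finite v (proj₁ Φcv)
  ; ⊆Q+      = λ Φcv → ⊆Q+ (proj₁ Φcv)
  ; ⋘-closed = closed
  }
  where
  open FundLowerSet L
  closed : ∀ {v w} → Φ c w → v ⋘ w → Φ c v
  closed {v} {w} (cw , a″ , b″ , P″ , cR″ , cL″) v⋘w@(a , b , a' , b' , Pv , Pw , b≼b' , a≼a') =
    let a'≡a″ , b'≡b″ = Parents-unique w a' b' a″ b″ Pw P″
        v≼w = subst₂ _≼_ (proj₁ Pv) (proj₁ Pw) (⊕-mono-≼ a≼a' b≼b')
        cR = subst (λ t → c (w ⊕ t)) (sym b'≡b″) cR″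
        cL = subst (λ t → c (w ⊕ t)) (sym a'≡a″) cL″
    in ⋘-closed cw v⋘w , a , b , Pv ,
       ⋘-closed cR (v , b , w , b' , Parents-childʳ v a b Pv , Parents-childʳ w a' b' Pw , b≼b' , v≼w) ,
       ⋘-closed cL (a , v , a' , w , Parents-childˡ v a b Pv , Parents-childˡ w a' b' Pw , v≼w , a≼a')

Φ^-fundLowerSet : ∀ {c} n → FundLowerSet c → FundLowerSet (Φ^ n c)
Φ^-fundLowerSet zero    L = L
Φ^-fundLowerSet (suc n) L = Φ-fundLowerSet (Φ^-fundLowerSet n L)

sublevel-fundLowerSet : (O : TotalOrder 0ℓ 0ℓ 0ℓ) (f : Q+ → TotalOrder.Carrier O) → FundMonotone O f →
                        ∀ R → Finite (Sublevel O f R) → FundLowerSet (Sublevel O f R)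
sublevel-fundLowerSet O f mono R fin = record { finite = fin ; ⊆Q+ = proj₁ ; ⋘-closed = closed }
  where
  closed : ∀ {v w} → Sublevel O f R w → v ⋘ w → Sublevel O f R v
  closed {v} (qw , fw≤R) v⋘w@(a , b , _ , _ , Pv , _) =
    let qv = Parents⇒Q+ v a b Pv
    in qv , TotalOrder.trans O (mono (v , qv) (_ , qw) v⋘w) fw≤R

theorem84 : (O : TotalOrder 0ℓ 0ℓ 0ℓ) → (f : Q+ → TotalOrder.Carrier O) → FundMonotone O f → (R : TotalOrder.Carrier O) → Finite (Sublevel O f R) → Corona (Sublevel O f R)
theorem84 O f mono R fin n = isStarSet (Φ^-fundLowerSet n (sublevel-fundLowerSet O f mono R fin))
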